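{- Let $n\ge 2$. Then \[ \alpha_n(t,q)=\big((n-2)tq+(n-1)t+2q+1\big)\alpha_{n-1}(t,q)+(t-t^2)(q+1)\frac{\partial}{\partial t}\alpha_{n-1}(t,q)+(1-t)(q^2+q)\frac{\partial}{\partial q}\alpha_{n-1}(t,q). \]
   Context: A segmented permutation of size $n$ is a permutation $\sigma=\sigma_1\cdots\sigma_n$ of $\{1,\dots,n\}$, written as a word, together with a choice, for each position $i\in\{1,\dots,n-1\}$, of whether or not a bar is placed between $\sigma_i$ and $\sigma_{i+1}$. $SP_n$ is the set of these. A position $i<n$ is a segmentation if there is a bar between $\sigma_i$ and $\sigma_{i+1}$, and a descent if it is not a segmentation and $\sigma_i>\sigma_{i+1}$. $\operatorname{des}(\sigma)$, $\operatorname{seg}(\sigma)$ are the numbers of descents and segmentations. $\alpha_n(t,q)=\sum_{\sigma\in SP_n}t^{\operatorname{des}(\sigma)}q^{\operatorname{seg}(\sigma)}$. -}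

module Defs where

open import Data.Nat using (ℕ; zero; suc; _+_; _∸_; _<ᵇ_; _≤ᵇ_; _≡ᵇ_)
open import Data.Bool using (Bool; true; false; not; _∧_; if_then_else_)
open import Data.Fin using (Fin; toℕ)
open import Data.Fin.Properties using (_≟_)
open import Data.List using (List; []; _∷_; map; filter; filterᵇ; length; allFin; cartesianProduct; concatMap)
open import Data.Vec using (Vec; toList)
import Data.Vec as V
open import Data.Product using (_×_; _,_; proj₁; proj₂)
open import Data.Integer using (ℤ; +_; _-_; _*_)
import Data.Integer as ℤ
open import Relation.Nullary.Decidable using (does)
import Data.List.Relation.Unary.Unique.DecPropositional as UDP

-- A permutation of {1,…,n} is represented as a word σ₁⋯σₙ over Fin n
-- (value k ↦ k+1, order-preserving) of length n with pairwise distinct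
-- letters; bars are a vector of n ∸ 1 booleans (true = bar between
-- positions i and i+1).

allWords : {A : Set} → List A → (m : ℕ) → List (Vec A m)
allWords xs zero    = V.[] ∷ []
allWords xs (suc m) = concatMap (λ x → map (x V.∷_) (allWords xs m)) xs

perms : (n : ℕ) → List (Vec (Fin n) n)
perms n = filter (λ w → UDP.unique? (_≟_ {n}) (toList w)) (allWords (allFin n) n)

barChoices : (n : ℕ) → List (Vec Bool (n ∸ 1))
barChoices n = allWords (true ∷ false ∷ []) (n ∸ 1)

SP : (n : ℕ) → List (Vec (Fin n) n × Vec Bool (n ∸ 1))
SP n = cartesianProduct (perms n) (barChoices n)

desW : List ℕ → List Bool → ℕ
desW (x ∷ y ∷ w) (b ∷ bs) = (if not b ∧ (y <ᵇ x) then 1 else 0) + desW (y ∷ w) bs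
desW _ _ = 0

segW : List Bool → ℕ
segW []           = 0
segW (true ∷ bs)  = suc (segW bs)
segW (false ∷ bs) = segW bs

des : {n : ℕ} → Vec (Fin n) n × Vec Bool (n ∸ 1) → ℕ
des (σ , b) = desW (toList (V.map toℕ σ)) (toList b)

seg : {n : ℕ} → Vec (Fin n) n × Vec Bool (n ∸ 1) → ℕ
seg (σ , b) = segW (toList b)

-- Bivariate polynomials in t, q with integer coefficients, represented
-- by their coefficient functions: p i j = coefficient of t^i q^j.

Poly : Set
Poly = ℕ → ℕ → ℤ

α : ℕ → Poly
α n i j = + length (filterᵇ (λ s → (des s ≡ᵇ i) ∧ (seg s ≡ᵇ j)) (SP n))

infixl 6 _⊕_
_⊕_ : Poly → Poly → Poly
(p ⊕ r) i j = p i j ℤ.+ r i j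

_·_ : ℤ → Poly → Poly
(c · p) i j = c * p i j
infixr 7 _·_

mon : ℕ → ℕ → Poly → Poly
mon a b p i j = if (a ≤ᵇ i) ∧ (b ≤ᵇ j) then p (i ∸ a) (j ∸ b) else + 0

∂t : Poly → Poly
∂t p i j = + (suc i) * p (suc i) j

∂q : Poly → Poly
∂q p i j = + (suc j) * p i (suc j)

module Submission where

open import Defs
open import Data.Nat using (ℕ; _≤_; _∸_)
open import Data.Integer using (+_; -_)
open import Relation.Binary.PropositionalEquality using (_≡_)

open import Data.Nat using (zero; suc; s≤s; _<_; _<ᵇ_; _≤ᵇ_; _≡ᵇ_)
import Data.Nat as ℕ
import Data.Nat.Properties as ℕ
open import Data.Bool using (Bool; true; false; T; not; _∧_; if_then_else_)
open import Data.Unit using (tt)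
open import Data.Fin using (Fin; toℕ) renaming (zero to fzero; suc to fsuc)
open import Data.Fin.Properties using (_≟_)
open import Data.Vec using (Vec; []; _∷_; toList; insertAt)
import Data.Vec as Vec
import Data.Vec.Properties as Vec
open import Data.List using (List; []; _∷_; _++_; map; filter; filterᵇ; length; allFin; cartesianProduct; concatMap)
import Data.List.Properties as List
import Data.List.Relation.Unary.All as All
import Data.List.Relation.Unary.Unique.DecPropositional as Unique
open import Data.Product using (_×_; _,_)
open import Data.Integer using (ℤ; 0ℤ; 1ℤ; _+_; _*_)
import Data.Integer.Properties as ℤ
open import Data.Integer.Tactic.RingSolver using (solve-∀)
open import Function using (_∘_; id)
open import Relation.Nullary.Decidable using (Dec; does; ¬?)
open import Relation.Binary.PropositionalEquality using (refl; sym; trans; cong; cong₂; subst; module ≡-Reasoning)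

-- Every segmented permutation of size m+2 arises exactly once from one of size m+1, say σ, by
-- shifting its letters up by one, inserting the new least letter 0 at one of the m+2 positions and
-- choosing a bar or no bar in the gap next to 0.  If σ has d descents, s bars and a = m-d-s ascents,
-- these 2(m+2) children contribute
--   (s+d+1) t^d q^s + (s+d+2) t^d q^(s+1) + (a+1) t^(d+1) q^s + a t^(d+1) q^(s+1)      (childWeight)
-- to α_(m+2), and this is exactly the right-hand side operator of the theorem (recOp) applied to the
-- monomial t^d q^s.  As recOp is linear, summing over σ ∈ SP_(m+1) gives the theorem.

-- Finite sums of integers over lists.

onlyIf : Bool → ℤ → ℤ
onlyIf b x = if b then x else 0ℤ

onlyIf-zero : ∀ b → onlyIf b 0ℤ ≡ 0ℤ
onlyIf-zero true  = refl
onlyIf-zero false = refl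

onlyIf-∧ : ∀ a b x → onlyIf (a ∧ b) x ≡ onlyIf b (onlyIf a x)
onlyIf-∧ true  b     x = refl
onlyIf-∧ false true  x = refl
onlyIf-∧ false false x = refl

∑ : {A : Set} → List A → (A → ℤ) → ℤ
∑ []       f = 0ℤ
∑ (x ∷ xs) f = f x + ∑ xs f

syntax ∑ xs (λ x → e) = ∑[ x ← xs ] e

module _ {A : Set} where

  ∑-cong : ∀ (xs : List A) {f g : A → ℤ} → (∀ x → f x ≡ g x) → ∑ xs f ≡ ∑ xs g
  ∑-cong []       f≡g = refl
  ∑-cong (x ∷ xs) f≡g = cong₂ _+_ (f≡g x) (∑-cong xs f≡g)

  ∑-++ : ∀ (xs ys : List A) (f : A → ℤ) → ∑ (xs ++ ys) f ≡ ∑ xs f + ∑ ys f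
  ∑-++ []       ys f = sym (ℤ.+-identityˡ _)
  ∑-++ (x ∷ xs) ys f = trans (cong (_+_ (f x)) (∑-++ xs ys f)) (sym (ℤ.+-assoc (f x) _ _))

  ∑-zero : ∀ (xs : List A) → ∑[ _ ← xs ] 0ℤ ≡ 0ℤ
  ∑-zero []       = refl
  ∑-zero (x ∷ xs) = trans (ℤ.+-identityˡ _) (∑-zero xs)

  ∑-+ : ∀ (xs : List A) (f g : A → ℤ) → ∑[ x ← xs ] (f x + g x) ≡ ∑ xs f + ∑ xs g
  ∑-+ []       f g = refl
  ∑-+ (x ∷ xs) f g = trans (cong (_+_ (f x + g x)) (∑-+ xs f g)) (interchange (f x) (g x) _ _)
    where
    interchange : ∀ a b c d → (a + b) + (c + d) ≡ (a + c) + (b + d)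
    interchange = solve-∀

  ∑-*ˡ : ∀ (xs : List A) (c : ℤ) (f : A → ℤ) → ∑[ x ← xs ] (c * f x) ≡ c * ∑ xs f
  ∑-*ˡ []       c f = sym (ℤ.*-zeroʳ c)
  ∑-*ˡ (x ∷ xs) c f = trans (cong (_+_ (c * f x)) (∑-*ˡ xs c f)) (sym (ℤ.*-distribˡ-+ c (f x) _))

  ∑-onlyIf : ∀ (xs : List A) (b : Bool) (f : A → ℤ) → ∑[ x ← xs ] onlyIf b (f x) ≡ onlyIf b (∑ xs f)
  ∑-onlyIf xs true  f = refl
  ∑-onlyIf xs false f = ∑-zero xs

  ∑-filter : ∀ {P : A → Set} (P? : ∀ x → Dec (P x)) (f : A → ℤ) (xs : List A) →
             ∑ (filter P? xs) f ≡ ∑[ x ← xs ] onlyIf (does (P? x)) (f x)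
  ∑-filter P? f []       = refl
  ∑-filter P? f (x ∷ xs) with does (P? x)
  ... | true  = cong (_+_ (f x)) (∑-filter P? f xs)
  ... | false = trans (∑-filter P? f xs) (sym (ℤ.+-identityˡ _))

  length-filterᵇ : ∀ (p : A → Bool) (xs : List A) → + length (filterᵇ p xs) ≡ ∑[ x ← xs ] onlyIf (p x) 1ℤ
  length-filterᵇ p []       = refl
  length-filterᵇ p (x ∷ xs) with p x
  ... | true  = cong (_+_ 1ℤ) (length-filterᵇ p xs)
  ... | false = trans (length-filterᵇ p xs) (sym (ℤ.+-identityˡ _))

∑-map : {A B : Set} (g : A → B) (xs : List A) (f : B → ℤ) → ∑ (map g xs) f ≡ ∑ xs (f ∘ g)
∑-map g []       f = refl
∑-map g (x ∷ xs) f = cong (_+_ (f (g x))) (∑-map g xs f)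

module _ {A B : Set} where

  ∑-concatMap : ∀ (g : A → List B) (xs : List A) (f : B → ℤ) →
                ∑ (concatMap g xs) f ≡ ∑[ x ← xs ] ∑ (g x) f
  ∑-concatMap g []       f = refl
  ∑-concatMap g (x ∷ xs) f = trans (∑-++ (g x) _ f) (cong (_+_ (∑ (g x) f)) (∑-concatMap g xs f))

  ∑-cartesianProduct : ∀ (xs : List A) (ys : List B) (f : A × B → ℤ) →
                       ∑ (cartesianProduct xs ys) f ≡ ∑[ x ← xs ] ∑[ y ← ys ] f (x , y)
  ∑-cartesianProduct []       ys f = refl
  ∑-cartesianProduct (x ∷ xs) ys f =
    trans (∑-++ (map (x ,_) ys) _ f) (cong₂ _+_ (∑-map (x ,_) ys f) (∑-cartesianProduct xs ys f))

  ∑-comm : ∀ (xs : List A) (ys : List B) (h : A → B → ℤ) →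
           ∑[ x ← xs ] ∑[ y ← ys ] h x y ≡ ∑[ y ← ys ] ∑[ x ← xs ] h x y
  ∑-comm []       ys h = sym (∑-zero ys)
  ∑-comm (x ∷ xs) ys h =
    trans (cong (_+_ (∑ ys (h x))) (∑-comm xs ys h)) (sym (∑-+ ys (h x) (λ y → ∑[ x ← xs ] h x y)))

∑-allFin-suc : ∀ n (f : Fin (suc n) → ℤ) → ∑ (allFin (suc n)) f ≡ f fzero + ∑[ k ← allFin n ] f (fsuc k)
∑-allFin-suc n f = cong (_+_ (f fzero))
  (trans (cong (λ ks → ∑ ks f) (sym (List.map-tabulate id fsuc))) (∑-map fsuc (allFin n) f))

∑-allWords-suc : {A : Set} (xs : List A) (m : ℕ) (f : Vec A (suc m) → ℤ) →
                 ∑ (allWords xs (suc m)) f ≡ ∑[ x ← xs ] ∑[ w ← allWords xs m ] f (x ∷ w)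
∑-allWords-suc xs m f = trans (∑-concatMap _ xs f) (∑-cong xs (λ x → ∑-map (x ∷_) (allWords xs m) f))

-- Permutations of Fin (N+1) by the position of the least letter.

words : (n m : ℕ) → List (Vec (Fin n) m)
words n m = allWords (allFin n) m

injective? : ∀ {n m} → Vec (Fin n) m → Bool
injective? w = does (Unique.unique? _≟_ (toList w))

-- the letter x does not occur in w; note injective? (x ∷ w) = avoids x w ∧ injective? w
avoids : ∀ {n m} → Fin n → Vec (Fin n) m → Bool
avoids x w = does (All.all? (λ y → ¬? (x ≟ y)) (toList w))

avoids-relabel : ∀ {n m} (y : Fin n) (v : Vec (Fin n) m) → avoids (fsuc y) (Vec.map fsuc v) ≡ avoids y v
avoids-relabel y []      = refl
avoids-relabel y (z ∷ v) = cong (not (does (y ≟ z)) ∧_) (avoids-relabel y v)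

avoids-zero-relabel : ∀ {n m} (v : Vec (Fin n) m) → avoids fzero (Vec.map fsuc v) ≡ true
avoids-zero-relabel []      = refl
avoids-zero-relabel (z ∷ v) = avoids-zero-relabel v

avoids-zero-insert : ∀ {n m} (v : Vec (Fin n) m) k → avoids fzero (insertAt (Vec.map fsuc v) k fzero) ≡ false
avoids-zero-insert v       fzero    = refl
avoids-zero-insert (z ∷ v) (fsuc k) = avoids-zero-insert v k

avoids-insert : ∀ {n m} (y : Fin n) (v : Vec (Fin n) m) k →
                avoids (fsuc y) (insertAt (Vec.map fsuc v) k fzero) ≡ avoids y v
avoids-insert y v       fzero    = avoids-relabel y v
avoids-insert y (z ∷ v) (fsuc k) = cong (not (does (y ≟ z)) ∧_) (avoids-insert y v k)

∑inj : (n m : ℕ) → (Vec (Fin n) m → ℤ) → ℤ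
∑inj n m g = ∑[ w ← words n m ] onlyIf (injective? w) (g w)

∑inj-cong : ∀ n m {f g : Vec (Fin n) m → ℤ} → (∀ w → f w ≡ g w) → ∑inj n m f ≡ ∑inj n m g
∑inj-cong n m f≡g = ∑-cong (words n m) (λ w → cong (onlyIf (injective? w)) (f≡g w))

∑inj-zero : ∀ n m → ∑inj n m (λ _ → 0ℤ) ≡ 0ℤ
∑inj-zero n m = trans (∑-cong (words n m) (λ w → onlyIf-zero (injective? w))) (∑-zero (words n m))

∑inj-+ : ∀ n m (f g : Vec (Fin n) m → ℤ) → ∑inj n m (λ w → f w + g w) ≡ ∑inj n m f + ∑inj n m g
∑inj-+ n m f g = trans (∑-cong (words n m) (λ w → onlyIf-+ (injective? w) (f w) (g w)))
                       (∑-+ (words n m) _ _)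
  where
  onlyIf-+ : ∀ b x y → onlyIf b (x + y) ≡ onlyIf b x + onlyIf b y
  onlyIf-+ true  x y = refl
  onlyIf-+ false x y = refl

∑inj-cons : ∀ n m (h : Vec (Fin n) (suc m) → ℤ) →
            ∑inj n (suc m) h ≡ ∑[ y ← allFin n ] ∑inj n m (λ v → onlyIf (avoids y v) (h (y ∷ v)))
∑inj-cons n m h = trans (∑-allWords-suc (allFin n) m _) (∑-cong (allFin n) λ y →
  ∑-cong (words n m) λ v → onlyIf-∧ (avoids y v) (injective? v) (h (y ∷ v)))

-- sum of g over the injective words of length m over Fin (suc n) containing the letter 0,
-- each written as an injective word over Fin n (shifted up by one) with 0 inserted at position k
∑withZero : (n m : ℕ) → (Vec (Fin (suc n)) m → ℤ) → ℤ
∑withZero n zero    g = 0ℤ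
∑withZero n (suc m) g = ∑inj n m (λ u → ∑[ k ← allFin (suc m) ] g (insertAt (Vec.map fsuc u) k fzero))

-- a word containing 0 never avoids 0
∑withZero-avoiding-zero : ∀ n m (h : Vec (Fin (suc n)) (suc m) → ℤ) →
                          ∑withZero n m (λ w → onlyIf (avoids fzero w) (h (fzero ∷ w))) ≡ 0ℤ
∑withZero-avoiding-zero n zero    h = refl
∑withZero-avoiding-zero n (suc m) h = trans (∑inj-cong n m λ u →
    trans (∑-cong (allFin (suc m)) λ k →
             cong (λ b → onlyIf b (h (fzero ∷ insertAt (Vec.map fsuc u) k fzero))) (avoids-zero-insert u k))
          (∑-zero (allFin (suc m))))
  (∑inj-zero n m)

-- the words in which 0 is not the first letter, grouped by their first letter
∑inj-zero-later : ∀ n m (g : Vec (Fin (suc n)) (suc m) → ℤ) →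
  ∑inj n m (λ u → ∑[ k ← allFin m ] g (insertAt (Vec.map fsuc u) (fsuc k) fzero))
  ≡ ∑[ y ← allFin n ] ∑withZero n m (λ w → onlyIf (avoids (fsuc y) w) (g (fsuc y ∷ w)))
∑inj-zero-later n zero    g = trans (∑inj-zero n zero) (sym (∑-zero (allFin n)))
∑inj-zero-later n (suc m) g = trans (∑inj-cons n m _) (∑-cong (allFin n) λ y → ∑inj-cong n m λ v →
  trans (sym (∑-onlyIf (allFin (suc m)) (avoids y v) _))
        (∑-cong (allFin (suc m)) λ k →
           cong (λ b → onlyIf b (g (fsuc y ∷ insertAt (Vec.map fsuc v) k fzero))) (sym (avoids-insert y v k))))

-- an injective word over Fin (suc n) either avoids 0 (and is a relabelled word over Fin n) or contains it
∑inj-split : ∀ n m (g : Vec (Fin (suc n)) m → ℤ) →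
             ∑inj (suc n) m g ≡ ∑inj n m (g ∘ Vec.map fsuc) + ∑withZero n m g
∑inj-split n zero    g = sym (ℤ.+-identityʳ _)
∑inj-split n (suc m) g = begin
    ∑inj (suc n) (suc m) g
  ≡⟨ trans (∑inj-cons (suc n) m g) (∑-allFin-suc n (λ y → ∑inj (suc n) m (G y))) ⟩
    ∑inj (suc n) m (G fzero) + ∑[ y ← allFin n ] ∑inj (suc n) m (G (fsuc y))
  ≡⟨ cong₂ _+_ firstZero (trans (∑-cong (allFin n) λ y → ∑inj-split n m (G (fsuc y))) (∑-+ (allFin n) _ _)) ⟩
    Z + (∑[ y ← allFin n ] ∑inj n m (G (fsuc y) ∘ Vec.map fsuc) + ∑[ y ← allFin n ] ∑withZero n m (G (fsuc y)))
  ≡⟨ cong₂ (λ a b → Z + (a + b)) firstNonzero (sym (∑inj-zero-later n m g)) ⟩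
    Z + (∑inj n (suc m) (g ∘ Vec.map fsuc) + L)
  ≡⟨ swap Z (∑inj n (suc m) (g ∘ Vec.map fsuc)) L ⟩
    ∑inj n (suc m) (g ∘ Vec.map fsuc) + (Z + L)
  ≡⟨ cong (_+_ (∑inj n (suc m) (g ∘ Vec.map fsuc))) (sym zeroAnywhere) ⟩
    ∑inj n (suc m) (g ∘ Vec.map fsuc) + ∑withZero n (suc m) g
  ∎
  where
  open ≡-Reasoning
  G : Fin (suc n) → Vec (Fin (suc n)) m → ℤ
  G y w = onlyIf (avoids y w) (g (y ∷ w))
  -- 0 is the first letter, resp. 0 occurs at a later position
  Z L : ℤ
  Z = ∑inj n m (λ v → g (fzero ∷ Vec.map fsuc v))
  L = ∑inj n m (λ u → ∑[ k ← allFin m ] g (insertAt (Vec.map fsuc u) (fsuc k) fzero))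
  firstZero : ∑inj (suc n) m (G fzero) ≡ Z
  firstZero = trans (∑inj-split n m (G fzero))
    (trans (cong₂ _+_ (∑inj-cong n m λ v →
                         cong (λ b → onlyIf b (g (fzero ∷ Vec.map fsuc v))) (avoids-zero-relabel v))
                      (∑withZero-avoiding-zero n m g))
           (ℤ.+-identityʳ Z))
  firstNonzero : ∑[ y ← allFin n ] ∑inj n m (G (fsuc y) ∘ Vec.map fsuc) ≡ ∑inj n (suc m) (g ∘ Vec.map fsuc)
  firstNonzero = trans (∑-cong (allFin n) λ y → ∑inj-cong n m λ v →
                          cong (λ b → onlyIf b (g (fsuc y ∷ Vec.map fsuc v))) (avoids-relabel y v))
                       (sym (∑inj-cons n m (g ∘ Vec.map fsuc)))
  zeroAnywhere : ∑withZero n (suc m) g ≡ Z + L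
  zeroAnywhere = trans (∑inj-cong n m λ u → ∑-allFin-suc m (λ k → g (insertAt (Vec.map fsuc u) k fzero)))
                       (∑inj-+ n m _ _)
  swap : ∀ a b c → a + (b + c) ≡ b + (a + c)
  swap = solve-∀

∑inj-overfull : ∀ n m (g : Vec (Fin n) m → ℤ) → n < m → ∑inj n m g ≡ 0ℤ
∑inj-overfull zero    (suc m) g _         = refl
∑inj-overfull (suc n) (suc m) g (s≤s n<m) = trans (∑inj-split n (suc m) g)
  (cong₂ _+_ (∑inj-overfull n (suc m) _ (ℕ.m<n⇒m<1+n n<m)) (∑inj-overfull n m _ n<m))

∑-perms-suc : ∀ N (g : Vec (Fin (suc N)) (suc N) → ℤ) →
  ∑ (perms (suc N)) g ≡ ∑[ u ← perms N ] ∑[ k ← allFin (suc N) ] g (insertAt (Vec.map fsuc u) k fzero)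
∑-perms-suc N g = begin
    ∑ (perms (suc N)) g
  ≡⟨ trans (∑-filter _ g (words (suc N) (suc N))) (∑inj-split N (suc N) g) ⟩
    ∑inj N (suc N) (g ∘ Vec.map fsuc) + ∑withZero N (suc N) g
  ≡⟨ trans (cong (_+ ∑withZero N (suc N) g) (∑inj-overfull N (suc N) _ (ℕ.n<1+n N))) (ℤ.+-identityˡ _) ⟩
    ∑withZero N (suc N) g
  ≡⟨ sym (∑-filter _ _ (words N N)) ⟩
    ∑[ u ← perms N ] ∑[ k ← allFin (suc N) ] g (insertAt (Vec.map fsuc u) k fzero)
  ∎
  where open ≡-Reasoning

-- Segmented words: bar insertion and the statistics of the children of a segmented word.

-- insert x at position k of a list (at the end if k exceeds its length)
insertL : {A : Set} → ℕ → A → List A → List A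
insertL zero    x ys       = x ∷ ys
insertL (suc k) x []       = x ∷ []
insertL (suc k) x (y ∷ ys) = y ∷ insertL k x ys

letters : ∀ {n m} → Vec (Fin n) m → List ℕ
letters w = toList (Vec.map toℕ w)

letters-insert : ∀ {n m} (v : Vec (Fin n) m) k x → letters (insertAt v k x) ≡ insertL (toℕ k) (toℕ x) (letters v)
letters-insert v       fzero    x = refl
letters-insert (y ∷ v) (fsuc k) x = cong (toℕ y ∷_) (letters-insert v k x)

letters-relabel : ∀ {n m} (u : Vec (Fin n) m) → letters (Vec.map fsuc u) ≡ map suc (letters u)
letters-relabel []      = refl
letters-relabel (y ∷ u) = cong (suc (toℕ y) ∷_) (letters-relabel u)

length-letters : ∀ {n m} (u : Vec (Fin n) m) → length (letters u) ≡ m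
length-letters u = Vec.length-toList (Vec.map toℕ u)

∑-allWords-insert : {A : Set} (xs : List A) (m k : ℕ) (H : List A → ℤ) →
  ∑[ w ← allWords xs (suc m) ] H (toList w) ≡ ∑[ c ← xs ] ∑[ w ← allWords xs m ] H (insertL k c (toList w))
∑-allWords-insert xs zero    k       H = trans (∑-allWords-suc xs zero (λ w → H (toList w)))
  (∑-cong xs λ c → cong (λ cs → H cs + 0ℤ) (insert-into-empty k c))
  where
  insert-into-empty : ∀ k c → c ∷ [] ≡ insertL k c []
  insert-into-empty zero    c = refl
  insert-into-empty (suc k) c = refl
∑-allWords-insert xs (suc m) zero    H = ∑-allWords-suc xs (suc m) (λ w → H (toList w))
∑-allWords-insert xs (suc m) (suc k) H = begin
    ∑[ w ← allWords xs (suc (suc m)) ] H (toList w)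
  ≡⟨ ∑-allWords-suc xs (suc m) (λ w → H (toList w)) ⟩
    ∑[ x ← xs ] ∑[ w ← allWords xs (suc m) ] H (x ∷ toList w)
  ≡⟨ ∑-cong xs (λ x → ∑-allWords-insert xs m k (λ cs → H (x ∷ cs))) ⟩
    ∑[ x ← xs ] ∑[ c ← xs ] ∑[ w ← allWords xs m ] H (x ∷ insertL k c (toList w))
  ≡⟨ ∑-comm xs xs (λ x c → ∑[ w ← allWords xs m ] H (x ∷ insertL k c (toList w))) ⟩
    ∑[ c ← xs ] ∑[ x ← xs ] ∑[ w ← allWords xs m ] H (insertL (suc k) c (toList (x ∷ w)))
  ≡⟨ ∑-cong xs (λ c → sym (∑-allWords-suc xs m (λ w → H (insertL (suc k) c (toList w))))) ⟩
    ∑[ c ← xs ] ∑[ w ← allWords xs (suc m) ] H (insertL (suc k) c (toList w))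
  ∎
  where open ≡-Reasoning

bools : List Bool
bools = true ∷ false ∷ []

ascW : List ℕ → List Bool → ℕ
ascW (x ∷ y ∷ w) (b ∷ bs) = (if not b ∧ not (y <ᵇ x) then 1 else 0) ℕ.+ ascW (y ∷ w) bs
ascW _ _ = 0

-- every gap is a descent, a segmentation or an ascent
des+seg+asc : ∀ w bs → length w ≡ suc (length bs) → desW w bs ℕ.+ segW bs ℕ.+ ascW w bs ≡ length bs
des+seg+asc (x ∷ [])    []           _  = refl
des+seg+asc (x ∷ y ∷ r) (true ∷ bs)  eq =
  trans (cong (ℕ._+ ascW (y ∷ r) bs) (ℕ.+-suc (desW (y ∷ r) bs) (segW bs)))
        (cong suc (des+seg+asc (y ∷ r) bs (ℕ.suc-injective eq)))
des+seg+asc (x ∷ y ∷ r) (false ∷ bs) eq with y <ᵇ x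
... | true  = cong suc (des+seg+asc (y ∷ r) bs (ℕ.suc-injective eq))
... | false = trans (ℕ.+-suc (desW (y ∷ r) bs ℕ.+ segW bs) (ascW (y ∷ r) bs))
                    (cong suc (des+seg+asc (y ∷ r) bs (ℕ.suc-injective eq)))
des+seg+asc []          _            ()
des+seg+asc (x ∷ [])    (b ∷ bs)     ()
des+seg+asc (x ∷ y ∷ r) []           ()

-- descents only depend on the relative order of the letters
desW-relabel : ∀ w bs → desW (map suc w) bs ≡ desW w bs
desW-relabel (x ∷ y ∷ w) (b ∷ bs) = cong ((if not b ∧ (y <ᵇ x) then 1 else 0) ℕ.+_) (desW-relabel (y ∷ w) bs)
desW-relabel []          bs       = refl
desW-relabel (x ∷ [])    bs       = refl
desW-relabel (x ∷ y ∷ w) []       = refl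

-- Total weight φ(des, seg) of the children of the segmented word (w, bs) obtained by inserting the
-- new least letter 0 at position k, with a bar or no bar in the gap next to it.
atPosition : (ℕ → ℕ → ℤ) → List ℕ → List Bool → ℕ → ℤ
atPosition φ w bs k = ∑[ c ← bools ] φ (desW (insertL k 0 (map suc w)) (insertL k c bs)) (segW (insertL k c bs))

-- The distribution of (des, seg) over the children of a segmented word with d descents, s bars and
-- a ascents: inserting 0 at a position k ≥ 1 (laterWeight), resp. at any position (childWeight).
laterWeight : (ℕ → ℕ → ℤ) → ℕ → ℕ → ℕ → ℤ
laterWeight φ d s a = (+ s + + d) * φ d s + (1ℤ + + s + + d) * φ d (suc s)
                    + (1ℤ + + a) * φ (suc d) s + + a * φ (suc d) (suc s)

childWeight : (ℕ → ℕ → ℤ) → ℕ → ℕ → ℕ → ℤ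
childWeight φ d s a = φ d s + φ d (suc s) + laterWeight φ d s a

-- inserting 0 right after a first letter followed by a bar creates a second bar
laterWeight-bar : ∀ φ d s a →
  φ d (suc (suc s)) + (φ d (suc s) + 0ℤ) + laterWeight (λ D S → φ D (suc S)) d s a ≡ laterWeight φ d (suc s) a
laterWeight-bar φ d s a =
  ring (+ s) (+ d) (+ a) (φ d (suc s)) (φ d (suc (suc s))) (φ (suc d) (suc s)) (φ (suc d) (suc (suc s)))
  where
  ring : ∀ S D A x y z u →
    y + (x + 0ℤ) + ((S + D) * x + (1ℤ + S + D) * y + (1ℤ + A) * z + A * u)
    ≡ ((1ℤ + S) + D) * x + (1ℤ + (1ℤ + S) + D) * y + (1ℤ + A) * z + A * u
  ring = solve-∀

-- inserting 0 right after an unbarred first letter creates a descent; the first gap of the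
-- original word becomes a descent (z = true) or an ascent (z = false) between later letters
laterWeight-unbarred : ∀ φ (z : Bool) d s a →
  φ (suc d) (suc s) + (φ (suc d) s + 0ℤ) + laterWeight (λ D S → φ ((if z then 1 else 0) ℕ.+ D) S) d s a
  ≡ laterWeight φ ((if z then 1 else 0) ℕ.+ d) s ((if not z then 1 else 0) ℕ.+ a)
laterWeight-unbarred φ true d s a =
  ring (+ s) (+ d) (+ a) (φ (suc d) s) (φ (suc d) (suc s)) (φ (suc (suc d)) s) (φ (suc (suc d)) (suc s))
  where
  ring : ∀ S D A x y z u →
    y + (x + 0ℤ) + ((S + D) * x + (1ℤ + S + D) * y + (1ℤ + A) * z + A * u)
    ≡ (S + (1ℤ + D)) * x + (1ℤ + S + (1ℤ + D)) * y + (1ℤ + A) * z + A * u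
  ring = solve-∀
laterWeight-unbarred φ false d s a =
  ring (+ s) (+ d) (+ a) (φ d s) (φ d (suc s)) (φ (suc d) s) (φ (suc d) (suc s))
  where
  ring : ∀ S D A x y z u →
    u + (z + 0ℤ) + ((S + D) * x + (1ℤ + S + D) * y + (1ℤ + A) * z + A * u)
    ≡ (S + D) * x + (1ℤ + S + D) * y + (1ℤ + (1ℤ + A)) * z + (1ℤ + A) * u
  ring = solve-∀

-- insertion positions 1, …, length w, by induction on the word: position 1 is treated directly,
-- the later ones are insertions into the tail with the first gap's contribution added to φ
laterChildren : ∀ φ w bs → length w ≡ suc (length bs) →
  ∑[ k ← allFin (length w) ] atPosition φ w bs (suc (toℕ k)) ≡ laterWeight φ (desW w bs) (segW bs) (ascW w bs)
laterChildren φ (x ∷ []) [] _ = ring (φ 0 0) (φ 0 1) (φ 1 0) (φ 1 1)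
  where
  ring : ∀ a b c e → b + (c + 0ℤ) + 0ℤ ≡ (0ℤ + 0ℤ) * a + (1ℤ + 0ℤ + 0ℤ) * b + (1ℤ + 0ℤ) * c + 0ℤ * e
  ring = solve-∀
laterChildren φ (x ∷ y ∷ r) (true ∷ bs) eq = begin
    ∑[ k ← allFin (length (x ∷ y ∷ r)) ] atPosition φ (x ∷ y ∷ r) (true ∷ bs) (suc (toℕ k))
  ≡⟨ ∑-allFin-suc (length (y ∷ r)) (λ k → atPosition φ (x ∷ y ∷ r) (true ∷ bs) (suc (toℕ k))) ⟩
    φ (desW (map suc (y ∷ r)) bs) (suc (suc s)) + (φ (desW (map suc (y ∷ r)) bs) (suc s) + 0ℤ)
    + ∑[ k ← allFin (length (y ∷ r)) ] atPosition φ′ (y ∷ r) bs (suc (toℕ k))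
  ≡⟨ cong₂ _+_ (cong (λ D → φ D (suc (suc s)) + (φ D (suc s) + 0ℤ)) (desW-relabel (y ∷ r) bs))
               (laterChildren φ′ (y ∷ r) bs (ℕ.suc-injective eq)) ⟩
    φ d (suc (suc s)) + (φ d (suc s) + 0ℤ) + laterWeight φ′ d s a
  ≡⟨ laterWeight-bar φ d s a ⟩
    laterWeight φ d (suc s) a
  ∎
  where
  open ≡-Reasoning
  d s a : ℕ
  d = desW (y ∷ r) bs
  s = segW bs
  a = ascW (y ∷ r) bs
  φ′ : ℕ → ℕ → ℤ
  φ′ D S = φ D (suc S)
laterChildren φ (x ∷ y ∷ r) (false ∷ bs) eq = begin
    ∑[ k ← allFin (length (x ∷ y ∷ r)) ] atPosition φ (x ∷ y ∷ r) (false ∷ bs) (suc (toℕ k))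
  ≡⟨ ∑-allFin-suc (length (y ∷ r)) (λ k → atPosition φ (x ∷ y ∷ r) (false ∷ bs) (suc (toℕ k))) ⟩
    φ (suc (desW (map suc (y ∷ r)) bs)) (suc s) + (φ (suc (desW (map suc (y ∷ r)) bs)) s + 0ℤ)
    + ∑[ k ← allFin (length (y ∷ r)) ] atPosition φ′ (y ∷ r) bs (suc (toℕ k))
  ≡⟨ cong₂ _+_ (cong (λ D → φ (suc D) (suc s) + (φ (suc D) s + 0ℤ)) (desW-relabel (y ∷ r) bs))
               (laterChildren φ′ (y ∷ r) bs (ℕ.suc-injective eq)) ⟩
    φ (suc d) (suc s) + (φ (suc d) s + 0ℤ) + laterWeight φ′ d s a
  ≡⟨ laterWeight-unbarred φ (y <ᵇ x) d s a ⟩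
    laterWeight φ ((if y <ᵇ x then 1 else 0) ℕ.+ d) s ((if not (y <ᵇ x) then 1 else 0) ℕ.+ a)
  ∎
  where
  open ≡-Reasoning
  d s a : ℕ
  d = desW (y ∷ r) bs
  s = segW bs
  a = ascW (y ∷ r) bs
  φ′ : ℕ → ℕ → ℤ
  φ′ D S = φ ((if y <ᵇ x then 1 else 0) ℕ.+ D) S
laterChildren φ []          _        ()
laterChildren φ (x ∷ [])    (b ∷ bs) ()
laterChildren φ (x ∷ y ∷ r) []       ()

-- all insertion positions: position 0 puts 0 in front, which adds no descent
allChildren : ∀ φ w bs → length w ≡ suc (length bs) →
  ∑[ k ← allFin (suc (length w)) ] atPosition φ w bs (toℕ k) ≡ childWeight φ (desW w bs) (segW bs) (ascW w bs)
allChildren φ []      bs ()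
allChildren φ (x ∷ r) bs eq = begin
    ∑[ k ← allFin (suc (length (x ∷ r))) ] atPosition φ (x ∷ r) bs (toℕ k)
  ≡⟨ ∑-allFin-suc (length (x ∷ r)) (λ k → atPosition φ (x ∷ r) bs (toℕ k)) ⟩
    φ (desW (map suc (x ∷ r)) bs) (suc s) + (φ (desW (map suc (x ∷ r)) bs) s + 0ℤ)
    + ∑[ k ← allFin (length (x ∷ r)) ] atPosition φ (x ∷ r) bs (suc (toℕ k))
  ≡⟨ cong₂ _+_ (cong (λ D → φ D (suc s) + (φ D s + 0ℤ)) (desW-relabel (x ∷ r) bs))
               (laterChildren φ (x ∷ r) bs eq) ⟩
    φ d (suc s) + (φ d s + 0ℤ) + laterWeight φ d s a
  ≡⟨ ring (φ d s) (φ d (suc s)) (laterWeight φ d s a) ⟩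
    childWeight φ d s a
  ∎
  where
  open ≡-Reasoning
  d s a : ℕ
  d = desW (x ∷ r) bs
  s = segW bs
  a = ascW (x ∷ r) bs
  ring : ∀ x y L → y + (x + 0ℤ) + L ≡ x + y + L
  ring = solve-∀

asc : ∀ {n} → Vec (Fin n) n × Vec Bool (n ∸ 1) → ℕ
asc (σ , b) = ascW (letters σ) (toList b)

letters-fit-bars : ∀ {n m} (u : Vec (Fin n) (suc m)) (b : Vec Bool m) → length (letters u) ≡ suc (length (toList b))
letters-fit-bars u b = trans (length-letters u) (cong suc (sym (Vec.length-toList b)))

des+seg+asc-SP : ∀ m (σ : Vec (Fin (suc m)) (suc m) × Vec Bool m) → des σ ℕ.+ seg σ ℕ.+ asc σ ≡ m
des+seg+asc-SP m (u , b) = trans (des+seg+asc (letters u) (toList b) (letters-fit-bars u b)) (Vec.length-toList b)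

children-of : ∀ m φ (u : Vec (Fin (suc m)) (suc m)) →
  ∑[ k ← allFin (suc (suc m)) ] ∑[ b ← allWords bools (suc m) ]
     φ (desW (letters (insertAt (Vec.map fsuc u) k fzero)) (toList b)) (segW (toList b))
  ≡ ∑[ b ← allWords bools m ]
      childWeight φ (desW (letters u) (toList b)) (segW (toList b)) (ascW (letters u) (toList b))
children-of m φ u = begin
    ∑[ k ← allFin (suc (suc m)) ] ∑[ b ← allWords bools (suc m) ]
       φ (desW (letters (insertAt (Vec.map fsuc u) k fzero)) (toList b)) (segW (toList b))
  ≡⟨ ∑-cong (allFin (suc (suc m))) (λ k → trans (∑-cong (allWords bools (suc m)) λ b →
        cong (λ v → φ (desW v (toList b)) (segW (toList b))) (letters-child k))
        (∑-allWords-insert bools m (toℕ k) (λ bs → φ (desW (insertL (toℕ k) 0 (map suc w)) bs) (segW bs)))) ⟩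
    ∑[ k ← allFin (suc (suc m)) ] ∑[ c ← bools ] ∑[ b ← allWords bools m ] H k c b
  ≡⟨ ∑-cong (allFin (suc (suc m))) (λ k → ∑-comm bools (allWords bools m) (H k)) ⟩
    ∑[ k ← allFin (suc (suc m)) ] ∑[ b ← allWords bools m ] atPosition φ w (toList b) (toℕ k)
  ≡⟨ ∑-comm (allFin (suc (suc m))) (allWords bools m) (λ k b → atPosition φ w (toList b) (toℕ k)) ⟩
    ∑[ b ← allWords bools m ] ∑[ k ← allFin (suc (suc m)) ] atPosition φ w (toList b) (toℕ k)
  ≡⟨ ∑-cong (allWords bools m) (λ b → trans
        (cong (λ n → ∑[ k ← allFin (suc n) ] atPosition φ w (toList b) (toℕ k)) (sym (length-letters u)))
        (allChildren φ w (toList b) (letters-fit-bars u b))) ⟩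
    ∑[ b ← allWords bools m ] childWeight φ (desW w (toList b)) (segW (toList b)) (ascW w (toList b))
  ∎
  where
  open ≡-Reasoning
  w : List ℕ
  w = letters u
  letters-child : ∀ k → letters (insertAt (Vec.map fsuc u) k fzero) ≡ insertL (toℕ k) 0 (map suc w)
  letters-child k = trans (letters-insert (Vec.map fsuc u) k fzero) (cong (insertL (toℕ k) 0) (letters-relabel u))
  -- the child with 0 at position k and bar choice c next to it, the other bars being b
  H : Fin (suc (suc m)) → Bool → Vec Bool m → ℤ
  H k c b = φ (desW (insertL (toℕ k) 0 (map suc w)) (insertL (toℕ k) c (toList b)))
              (segW (insertL (toℕ k) c (toList b)))

∑-SP-children : ∀ m (φ : ℕ → ℕ → ℤ) →
  ∑[ σ ← SP (suc (suc m)) ] φ (des σ) (seg σ) ≡ ∑[ σ ← SP (suc m) ] childWeight φ (des σ) (seg σ) (asc σ)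
∑-SP-children m φ = begin
    ∑[ σ ← SP (suc (suc m)) ] φ (des σ) (seg σ)
  ≡⟨ ∑-cartesianProduct (perms (suc (suc m))) (allWords bools (suc m)) _ ⟩
    ∑[ u ← perms (suc (suc m)) ] ∑[ b ← allWords bools (suc m) ] φ (desW (letters u) (toList b)) (segW (toList b))
  ≡⟨ ∑-perms-suc (suc m) _ ⟩
    ∑[ u ← perms (suc m) ] ∑[ k ← allFin (suc (suc m)) ] ∑[ b ← allWords bools (suc m) ]
       φ (desW (letters (insertAt (Vec.map fsuc u) k fzero)) (toList b)) (segW (toList b))
  ≡⟨ ∑-cong (perms (suc m)) (children-of m φ) ⟩
    ∑[ u ← perms (suc m) ] ∑[ b ← allWords bools m ]
       childWeight φ (desW (letters u) (toList b)) (segW (toList b)) (ascW (letters u) (toList b))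
  ≡⟨ sym (∑-cartesianProduct (perms (suc m)) (allWords bools m) _) ⟩
    ∑[ σ ← SP (suc m) ] childWeight φ (des σ) (seg σ) (asc σ)
  ∎
  where open ≡-Reasoning

-- Polynomials as coefficient functions: monomials, the operator recOp and its linearity.

infix 4 _≈_
_≈_ : Poly → Poly → Set
p ≈ r = ∀ i j → p i j ≡ r i j

∑P : {A : Set} → List A → (A → Poly) → Poly
∑P xs F i j = ∑[ x ← xs ] F x i j

-- The right-hand side of the theorem as an operator on polynomials, n being the size of the result:
-- recOp n p = ((n-2)tq + (n-1)t + 2q + 1) p + (t - t²)(q + 1) ∂ₜp + (1 - t)(q² + q) ∂_q p
recOp : ℕ → Poly → Poly
recOp n p = (+ (n ∸ 2) · mon 1 1 p)
          ⊕ (+ (n ∸ 1) · mon 1 0 p)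
          ⊕ (+ 2 · mon 0 1 p)
          ⊕ p
          ⊕ mon 1 1 (∂t p)
          ⊕ mon 1 0 (∂t p)
          ⊕ (- (+ 1) · mon 2 1 (∂t p))
          ⊕ (- (+ 1) · mon 2 0 (∂t p))
          ⊕ mon 0 2 (∂q p)
          ⊕ mon 0 1 (∂q p)
          ⊕ (- (+ 1) · mon 1 2 (∂q p))
          ⊕ (- (+ 1) · mon 1 1 (∂q p))

-- The operations occurring in recOp commute with finite sums, hence so does recOp.
module _ {A : Set} (xs : List A) where

  mon-∑ : ∀ {F p} a b → p ≈ ∑P xs F → mon a b p ≈ ∑P xs (λ x → mon a b (F x))
  mon-∑ {F} a b p≈ i j = trans (cong (onlyIf ((a ≤ᵇ i) ∧ (b ≤ᵇ j))) (p≈ (i ∸ a) (j ∸ b)))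
                               (sym (∑-onlyIf xs _ (λ x → F x (i ∸ a) (j ∸ b))))

  ∂t-∑ : ∀ {F p} → p ≈ ∑P xs F → ∂t p ≈ ∑P xs (λ x → ∂t (F x))
  ∂t-∑ {F} p≈ i j = trans (cong (+ suc i *_) (p≈ (suc i) j)) (sym (∑-*ˡ xs (+ suc i) (λ x → F x (suc i) j)))

  ∂q-∑ : ∀ {F p} → p ≈ ∑P xs F → ∂q p ≈ ∑P xs (λ x → ∂q (F x))
  ∂q-∑ {F} p≈ i j = trans (cong (+ suc j *_) (p≈ i (suc j))) (sym (∑-*ˡ xs (+ suc j) (λ x → F x i (suc j))))

  ·-∑ : ∀ {F p} c → p ≈ ∑P xs F → c · p ≈ ∑P xs (λ x → c · F x)
  ·-∑ {F} c p≈ i j = trans (cong (c *_) (p≈ i j)) (sym (∑-*ˡ xs c (λ x → F x i j)))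

  infixl 6 _⟨⊕⟩_
  _⟨⊕⟩_ : ∀ {F G p r} → p ≈ ∑P xs F → r ≈ ∑P xs G → p ⊕ r ≈ ∑P xs (λ x → F x ⊕ G x)
  _⟨⊕⟩_ {F} {G} p≈ r≈ i j =
    trans (cong₂ _+_ (p≈ i j) (r≈ i j)) (sym (∑-+ xs (λ x → F x i j) (λ x → G x i j)))

  recOp-∑ : ∀ n {F : A → Poly} {p : Poly} → p ≈ ∑P xs F → recOp n p ≈ ∑P xs (λ x → recOp n (F x))
  recOp-∑ n p≈ =
    ·-∑ (+ (n ∸ 2)) (mon-∑ 1 1 p≈) ⟨⊕⟩ ·-∑ (+ (n ∸ 1)) (mon-∑ 1 0 p≈) ⟨⊕⟩ ·-∑ (+ 2) (mon-∑ 0 1 p≈) ⟨⊕⟩ p≈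
    ⟨⊕⟩ mon-∑ 1 1 (∂t-∑ p≈) ⟨⊕⟩ mon-∑ 1 0 (∂t-∑ p≈)
    ⟨⊕⟩ ·-∑ (- (+ 1)) (mon-∑ 2 1 (∂t-∑ p≈)) ⟨⊕⟩ ·-∑ (- (+ 1)) (mon-∑ 2 0 (∂t-∑ p≈))
    ⟨⊕⟩ mon-∑ 0 2 (∂q-∑ p≈) ⟨⊕⟩ mon-∑ 0 1 (∂q-∑ p≈)
    ⟨⊕⟩ ·-∑ (- (+ 1)) (mon-∑ 1 2 (∂q-∑ p≈)) ⟨⊕⟩ ·-∑ (- (+ 1)) (mon-∑ 1 1 (∂q-∑ p≈))

δ : ℕ → ℕ → ℤ
δ d i = if d ≡ᵇ i then 1ℤ else 0ℤ

-- the coefficients of d·x^(d-1), the derivative of x^d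
∂δ : ℕ → ℕ → ℤ
∂δ d i = + suc i * δ d (suc i)

monomial : ℕ → ℕ → Poly
monomial d s i j = δ d i * δ s j

α-expansion : ∀ n → α n ≈ ∑P (SP n) (λ σ → monomial (des σ) (seg σ))
α-expansion n i j =
  trans (length-filterᵇ _ (SP n)) (∑-cong (SP n) λ σ → indicator-product (des σ ≡ᵇ i) (seg σ ≡ᵇ j))
  where
  indicator-product : ∀ a b → onlyIf (a ∧ b) 1ℤ ≡ (if a then 1ℤ else 0ℤ) * (if b then 1ℤ else 0ℤ)
  indicator-product true  true  = refl
  indicator-product true  false = refl
  indicator-product false true  = refl
  indicator-product false false = refl

raise : ℕ → (ℕ → ℤ) → ℕ → ℤ
raise a g i = if a ≤ᵇ i then g (i ∸ a) else 0ℤ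

raise-suc : ∀ a g i → raise (suc a) g (suc i) ≡ raise a g i
raise-suc zero    g i = refl
raise-suc (suc a) g i = refl

raise-δ : ∀ a d i → raise a (δ d) i ≡ δ (a ℕ.+ d) i
raise-δ zero    d i       = refl
raise-δ (suc a) d zero    = refl
raise-δ (suc a) d (suc i) = trans (raise-suc a (δ d) i) (raise-δ a d i)

δ-weight : ∀ k d → + k * δ d k ≡ + d * δ d k
δ-weight k d with d ≡ᵇ k in eq
... | true  = cong (λ n → + n * 1ℤ) (sym (ℕ.≡ᵇ⇒≡ d k (subst T (sym eq) tt)))
... | false = trans (ℤ.*-zeroʳ (+ k)) (sym (ℤ.*-zeroʳ (+ d)))

raise-∂δ : ∀ a d i → raise (suc a) (∂δ d) i ≡ + d * δ (a ℕ.+ d) i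
raise-∂δ zero    zero    zero    = refl
raise-∂δ zero    (suc d) zero    = sym (ℤ.*-zeroʳ (+ suc d))
raise-∂δ zero    d       (suc i) = δ-weight (suc i) d
raise-∂δ (suc a) d       zero    = sym (ℤ.*-zeroʳ (+ d))
raise-∂δ (suc a) d       (suc i) = trans (raise-suc (suc a) (∂δ d) i) (raise-∂δ a d i)

mon-product : ∀ a b (g h : ℕ → ℤ) i j → mon a b (λ i j → g i * h j) i j ≡ raise a g i * raise b h j
mon-product a b g h i j with a ≤ᵇ i | b ≤ᵇ j
... | true  | true  = refl
... | true  | false = sym (ℤ.*-zeroʳ (g (i ∸ a)))
... | false | true  = sym (ℤ.*-zeroˡ (h (j ∸ b)))
... | false | false = refl

mon-cong : ∀ a b {p r : Poly} → p ≈ r → mon a b p ≈ mon a b r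
mon-cong a b p≈r i j = cong (onlyIf ((a ≤ᵇ i) ∧ (b ≤ᵇ j))) (p≈r (i ∸ a) (j ∸ b))

mon-monomial : ∀ a b d s → mon a b (monomial d s) ≈ monomial (a ℕ.+ d) (b ℕ.+ s)
mon-monomial a b d s i j =
  trans (mon-product a b (δ d) (δ s) i j) (cong₂ _*_ (raise-δ a d i) (raise-δ b s j))

mon-∂t-monomial : ∀ a b d s i j → mon (suc a) b (∂t (monomial d s)) i j ≡ + d * monomial (a ℕ.+ d) (b ℕ.+ s) i j
mon-∂t-monomial a b d s i j = begin
    mon (suc a) b (∂t (monomial d s)) i j
  ≡⟨ mon-cong (suc a) b (λ i j → sym (ℤ.*-assoc (+ suc i) (δ d (suc i)) (δ s j))) i j ⟩
    mon (suc a) b (λ i j → ∂δ d i * δ s j) i j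
  ≡⟨ mon-product (suc a) b (∂δ d) (δ s) i j ⟩
    raise (suc a) (∂δ d) i * raise b (δ s) j
  ≡⟨ cong₂ _*_ (raise-∂δ a d i) (raise-δ b s j) ⟩
    + d * δ (a ℕ.+ d) i * δ (b ℕ.+ s) j
  ≡⟨ ℤ.*-assoc (+ d) (δ (a ℕ.+ d) i) (δ (b ℕ.+ s) j) ⟩
    + d * monomial (a ℕ.+ d) (b ℕ.+ s) i j
  ∎
  where open ≡-Reasoning

mon-∂q-monomial : ∀ a b d s i j → mon a (suc b) (∂q (monomial d s)) i j ≡ + s * monomial (a ℕ.+ d) (b ℕ.+ s) i j
mon-∂q-monomial a b d s i j = begin
    mon a (suc b) (∂q (monomial d s)) i j
  ≡⟨ mon-cong a (suc b) (λ i j → rearrange (+ suc j) (δ d i) (δ s (suc j))) i j ⟩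
    mon a (suc b) (λ i j → δ d i * ∂δ s j) i j
  ≡⟨ mon-product a (suc b) (δ d) (∂δ s) i j ⟩
    raise a (δ d) i * raise (suc b) (∂δ s) j
  ≡⟨ cong₂ _*_ (raise-δ a d i) (raise-∂δ b s j) ⟩
    δ (a ℕ.+ d) i * (+ s * δ (b ℕ.+ s) j)
  ≡⟨ sym (rearrange (+ s) (δ (a ℕ.+ d) i) (δ (b ℕ.+ s) j)) ⟩
    + s * monomial (a ℕ.+ d) (b ℕ.+ s) i j
  ∎
  where
  open ≡-Reasoning
  rearrange : ∀ c x y → c * (x * y) ≡ x * (c * y)
  rearrange = solve-∀

recOp-monomial : ∀ {m} d s a → d ℕ.+ s ℕ.+ a ≡ m →
                 recOp (suc (suc m)) (monomial d s) ≈ (λ i j → childWeight (λ d s → monomial d s i j) d s a)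
recOp-monomial d s a refl i j = trans
  (  cong (+ (d ℕ.+ s ℕ.+ a) *_) (mon-monomial 1 1 d s i j)
   ⟨+⟩ cong (+ suc (d ℕ.+ s ℕ.+ a) *_) (mon-monomial 1 0 d s i j)
   ⟨+⟩ cong (+ 2 *_) (mon-monomial 0 1 d s i j) ⟨+⟩ refl
   ⟨+⟩ mon-∂t-monomial 0 1 d s i j ⟨+⟩ mon-∂t-monomial 0 0 d s i j
   ⟨+⟩ cong (- (+ 1) *_) (mon-∂t-monomial 1 1 d s i j) ⟨+⟩ cong (- (+ 1) *_) (mon-∂t-monomial 1 0 d s i j)
   ⟨+⟩ mon-∂q-monomial 0 1 d s i j ⟨+⟩ mon-∂q-monomial 0 0 d s i j
   ⟨+⟩ cong (- (+ 1) *_) (mon-∂q-monomial 1 1 d s i j) ⟨+⟩ cong (- (+ 1) *_) (mon-∂q-monomial 1 0 d s i j))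
  (collect (+ d) (+ s) (+ a)
           (monomial d s i j) (monomial d (suc s) i j) (monomial (suc d) s i j) (monomial (suc d) (suc s) i j))
  where
  infixl 6 _⟨+⟩_
  _⟨+⟩_ : ∀ {x x′ y y′ : ℤ} → x ≡ x′ → y ≡ y′ → x + y ≡ x′ + y′
  _⟨+⟩_ = cong₂ _+_
  -- x₀₀, x₀₁, x₁₀, x₁₁ stand for t^d q^s, t^d q^(s+1), t^(d+1) q^s, t^(d+1) q^(s+1)
  collect : ∀ D S A x₀₀ x₀₁ x₁₀ x₁₁ →
      (D + S + A) * x₁₁ + (1ℤ + (D + S + A)) * x₁₀ + (1ℤ + 1ℤ) * x₀₁ + x₀₀
    + D * x₀₁ + D * x₀₀ + - 1ℤ * (D * x₁₁) + - 1ℤ * (D * x₁₀)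
    + S * x₀₁ + S * x₀₀ + - 1ℤ * (S * x₁₁) + - 1ℤ * (S * x₁₀)
    ≡ x₀₀ + x₀₁ + ((S + D) * x₀₀ + (1ℤ + S + D) * x₀₁ + (1ℤ + A) * x₁₀ + A * x₁₁)
  collect = solve-∀

mainTheorem8 : (n : ℕ) → 2 ≤ n → (i j : ℕ) →
    α n i j ≡
      ((+ (n ∸ 2) · mon 1 1 (α (n ∸ 1)))
       ⊕ (+ (n ∸ 1) · mon 1 0 (α (n ∸ 1)))
       ⊕ (+ 2 · mon 0 1 (α (n ∸ 1)))
       ⊕ α (n ∸ 1)
       ⊕ mon 1 1 (∂t (α (n ∸ 1)))
       ⊕ mon 1 0 (∂t (α (n ∸ 1)))
       ⊕ (- (+ 1) · mon 2 1 (∂t (α (n ∸ 1))))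
       ⊕ (- (+ 1) · mon 2 0 (∂t (α (n ∸ 1))))
       ⊕ mon 0 2 (∂q (α (n ∸ 1)))
       ⊕ mon 0 1 (∂q (α (n ∸ 1)))
       ⊕ (- (+ 1) · mon 1 2 (∂q (α (n ∸ 1))))
       ⊕ (- (+ 1) · mon 1 1 (∂q (α (n ∸ 1))))) i j
mainTheorem8 zero          ()            i j
mainTheorem8 (suc zero)    (s≤s ())      i j
mainTheorem8 (suc (suc m)) _ i j = begin
    α (suc (suc m)) i j
  ≡⟨ α-expansion (suc (suc m)) i j ⟩
    ∑[ σ ← SP (suc (suc m)) ] φ (des σ) (seg σ)
  ≡⟨ ∑-SP-children m φ ⟩
    ∑[ σ ← SP (suc m) ] childWeight φ (des σ) (seg σ) (asc σ)
  ≡⟨ ∑-cong (SP (suc m)) (λ σ → sym (recOp-monomial (des σ) (seg σ) (asc σ) (des+seg+asc-SP m σ) i j)) ⟩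
    ∑[ σ ← SP (suc m) ] recOp (suc (suc m)) (monomial (des σ) (seg σ)) i j
  ≡⟨ sym (recOp-∑ (SP (suc m)) (suc (suc m)) (α-expansion (suc m)) i j) ⟩
    recOp (suc (suc m)) (α (suc m)) i j
  ∎
  where
  open ≡-Reasoning
  φ : ℕ → ℕ → ℤ
  φ d s = monomial d s i j
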